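{- Let $n$ be an even positive integer and $p=\frac{\sqrt{n+1}-1}{2}$. If $\vec P_n$ is an alternating path on $n$ vertices, then \[\operatorname{th}(\vec P_n)\le \frac n2+\left\lceil\frac{\frac n2-\lceil p\rceil}{2\lceil p\rceil+1}\right\rceil+\lceil p\rceil.\]
   Context: An alternating path on $n$ vertices is an orientation of the path $P_n$ in which every vertex is a source (in-degree $0$) or a sink (out-degree $0$). Zero forcing on a digraph: vertices are blue or white; a blue vertex $u$ with exactly one white out-neighbor $w$ may force $w$ ($u\to w$), turning it blue. A set $\mathcal F$ of forces is a set of forces of $B\subseteq V$ if, starting with exactly $B$ blue, the forces in $\mathcal F$ can be validly performed in some order after which no further force is possible. Put $\mathcal F^{[0]}=B$ and $\mathcal F^{[t+1]}=\mathcal F^{[t]}\cup\{w\notin\mathcal F^{[t]}:(u\to w)\in\mathcal F,\ u\in\mathcal F^{[t]},\ w$ the only out-neighbor of $u$ outside $\mathcal F^{[t]}\}$; $\operatorname{pt}(\Gamma;\mathcal F)$ is the least $t$ with $\mathcal F^{[t]}=V$ ($\infty$ if none); $\operatorname{pt}(\Gamma;B)=\min_{\mathcal F}\operatorname{pt}(\Gamma;\mathcal F)$; $\operatorname{th}(\Gamma)=\min_{B\subseteq V}(|B|+\operatorname{pt}(\Gamma;B))$. -}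

module Defs where

open import Data.Nat using (ℕ; zero; suc; _+_; _*_; _∸_; _≤_; _<_)
open import Data.Nat.DivMod using (_/_)
open import Data.Fin using (Fin; toℕ)
open import Data.Fin.Subset using (Subset; _∈_; _∉_; ⁅_⁆; _∪_; ∣_∣)
open import Data.Bool using (Bool; true; false)
open import Data.Product using (_×_; _,_; Σ; ∃)
open import Data.Sum using (_⊎_)
open import Data.List using (List; []; _∷_)
open import Data.List.Membership.Propositional using () renaming (_∈_ to _∈ₗ_)
open import Data.List.Relation.Binary.Permutation.Propositional using (_↭_)
open import Data.Unit using (⊤)
open import Relation.Nullary using (¬_)
open import Relation.Binary.PropositionalEquality using (_≡_)

-- A digraph on vertex set Fin n, given by its (Boolean) arc relation:
-- Γ u w ≡ true  means there is an arc u → w.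
Digraph : ℕ → Set
Digraph n = Fin n → Fin n → Bool

-- Γ is an orientation of the path P_n with vertices 0,1,…,n-1
-- (edges {i,i+1}): every arc joins consecutive vertices, and each
-- path edge is oriented in exactly one direction.
IsPathOrientation : {n : ℕ} → Digraph n → Set
IsPathOrientation {n} Γ =
  (∀ i j → Γ i j ≡ true → (toℕ j ≡ suc (toℕ i)) ⊎ (toℕ i ≡ suc (toℕ j)))
  × (∀ i j → toℕ j ≡ suc (toℕ i) →
       (Γ i j ≡ true × Γ j i ≡ false) ⊎ (Γ i j ≡ false × Γ j i ≡ true))

IsAlternating : {n : ℕ} → Digraph n → Set
IsAlternating {n} Γ = ∀ v → (∀ u → Γ u v ≡ false) ⊎ (∀ w → Γ v w ≡ false)

IsAlternatingPath : {n : ℕ} → Digraph n → Set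
IsAlternatingPath Γ = IsPathOrientation Γ × IsAlternating Γ

Force : ℕ → Set
Force n = Fin n × Fin n

CanForce : {n : ℕ} → Digraph n → Subset n → Fin n → Fin n → Set
CanForce Γ S u w =
  u ∈ S × w ∉ S × Γ u w ≡ true × (∀ x → Γ u x ≡ true → x ∉ S → x ≡ w)

ValidSeq : {n : ℕ} → Digraph n → Subset n → List (Force n) → Set
ValidSeq Γ S [] = ⊤
ValidSeq Γ S ((u , w) ∷ fs) = CanForce Γ S u w × ValidSeq Γ (⁅ w ⁆ ∪ S) fs

after : {n : ℕ} → Subset n → List (Force n) → Subset n
after S [] = S
after S ((u , w) ∷ fs) = after (⁅ w ⁆ ∪ S) fs

Stalled : {n : ℕ} → Digraph n → Subset n → Set
Stalled Γ S = ∀ u w → ¬ CanForce Γ S u w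

-- F is a set of forces of B: the forces of F can be validly performed in
-- some order (each exactly once), after which no further force is possible
IsForceSetOf : {n : ℕ} → Digraph n → Subset n → List (Force n) → Set
IsForceSetOf Γ B F =
  Σ (List _) λ σ → (σ ↭ F) × ValidSeq Γ B σ × Stalled Γ (after B σ)

Round : {n : ℕ} → Digraph n → Subset n → List (Force n) → ℕ → Fin n → Set
Round Γ B F zero x = x ∈ B
Round Γ B F (suc t) x =
  Round Γ B F t x
  ⊎ (¬ Round Γ B F t x
     × ∃ λ u → ((u , x) ∈ₗ F) × Round Γ B F t u × Γ u x ≡ true
       × (∀ y → Γ u y ≡ true → ¬ Round Γ B F t y → y ≡ x))

-- pt(Γ;F) ≤ t   (i.e. F^[t] = V; the sequence F^[t] is increasing)
PtAtMost : {n : ℕ} → Digraph n → Subset n → List (Force n) → ℕ → Set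
PtAtMost Γ B F t = ∀ x → Round Γ B F t x

-- th(Γ) ≤ k, unfolding th(Γ) = min_B (|B| + min_F pt(Γ;F)) over finite sets:
-- there are B, a set of forces F of B and t with pt(Γ;F) ≤ t and |B| + t ≤ k
ThrottlingAtMost : {n : ℕ} → Digraph n → ℕ → Set
ThrottlingAtMost {n} Γ k =
  Σ (Subset n) λ B → Σ (List (Force n)) λ F → Σ ℕ λ t →
    IsForceSetOf Γ B F × PtAtMost Γ B F t × (∣ B ∣ + t ≤ k)

-- ⌈a / (2q+1)⌉
ceilDivOdd : ℕ → ℕ → ℕ
ceilDivOdd a q = (a + 2 * q) / suc (2 * q)

-- q = ⌈(√(n+1) - 1)/2⌉ iff q is the least natural with (2q+1)² ≥ n+1
IsCeilP : ℕ → ℕ → Set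
IsCeilP n q = (suc n ≤ (2 * q + 1) * (2 * q + 1))
  × (∀ r → suc n ≤ (2 * r + 1) * (2 * r + 1) → q ≤ r)

-- All m = n/2 sources of an alternating path have in-degree 0, so they must be blue from the
-- start, and a source forces one of its (at most two) sink neighbours as soon as the other
-- one is blue.  So blue spreads along the sequence of sinks by one sink per round, in both
-- directions from every initially blue sink, and also from the end of the path that is a
-- source: its only out-neighbour is forced in round 1.  With q initially blue sinks spaced
-- 2T + 1 apart, the first at distance T from the sink end, every sink is blue after T rounds
-- as soon as m ≤ T + q (2T + 1), which holds for T = ⌈(m - q)/(2q + 1)⌉.
module Submission where

open import Defs
open import Data.Bool using (Bool; true; false; if_then_else_)
open import Data.Bool.Properties using (T-≡)
open import Data.Empty using (⊥; ⊥-elim)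
open import Data.Fin using (Fin; zero; toℕ; fromℕ<; opposite) renaming (_≟_ to _≟ᶠ_)
open import Data.Fin.Properties
  using (toℕ-fromℕ<; toℕ<n; toℕ-injective; opposite-prop; opposite-involutive)
open import Data.Fin.Subset using (Subset; _∈_; _∉_; ⁅_⁆; _∪_; ∣_∣)
open import Data.Fin.Subset.Properties using (x∈⁅y⁆⇔x≡y; ∪⇔⊎)
open import Data.List using (List; []; _∷_; _++_; map; filter; allFin)
open import Data.List.Membership.Propositional using () renaming (_∈_ to _∈ₗ_; _∉_ to _∉ₗ_)
open import Data.List.Membership.Propositional.Properties
  using (∈-allFin; ∈-map⁺; ∈-map⁻; ∈-++⁺ˡ; ∈-++⁺ʳ; ∈-++⁻; ∈-filter⁺; ∈-filter⁻)
open import Data.List.Relation.Binary.Permutation.Propositional using (↭-refl)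
open import Data.List.Relation.Unary.All as All using (All; []; _∷_)
open import Data.List.Relation.Unary.All.Properties using (all-filter)
open import Data.List.Relation.Unary.Any using (here; there)
open import Data.List.Relation.Unary.AllPairs using (_∷_)
open import Data.List.Relation.Unary.Unique.Propositional using (Unique)
open import Data.List.Relation.Unary.Unique.Propositional.Properties using (allFin⁺; filter⁺)
open import Data.Nat
  using (ℕ; zero; suc; _+_; _*_; _∸_; _≤_; _<_; _⊓_; ∣_-_∣; _≡ᵇ_; ⌊_/2⌋; z≤n; s≤s;
         _≟_; _<?_; _≤?_; NonZero)
open import Data.Nat.DivMod
  using (_/_; _%_; m≡m%n+[m/n]*n; [m+kn]%n≡m%n; [m+n]%n≡m%n; m<n⇒m%n≡m; m*n%n≡0; m%n<n; m*n/n≡m)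
open import Data.Nat.Divisibility using (_∣_; divides)
open import Data.Nat.Properties
open import Algebra.Properties.CommutativeSemigroup +-commutativeSemigroup
  using (interchange; x∙yz≈y∙xz)
open import Data.Nat.Tactic.RingSolver using (solve-∀)
import Data.Product as Product
open import Data.Product using (_×_; _,_; ∃; proj₁; proj₂)
import Data.Sum as Sum
open import Data.Sum using (_⊎_; inj₁; inj₂)
open import Data.Sum.Function.Propositional using (_⊎-⇔_)
open import Data.Unit using (tt)
open import Data.Vec using (tabulate)
open import Data.Vec.Properties using (lookup∘tabulate; []=⇒lookup; lookup⇒[]=; tabulate-cong)
open import Function using (_∘_; _⇔_; mk⇔; Equivalence)
import Function.Properties.Equivalence as ⇔
open import Relation.Nullary using (¬_; Dec; does; yes; no)
open import Relation.Binary.PropositionalEquality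
  using (_≡_; _≢_; refl; sym; trans; cong; cong₂; subst; subst₂; module ≡-Reasoning)

private
  true≢false : true ≢ false
  true≢false ()

-- Counting on ℕ

≡ᵇ-true⇒≡ : ∀ {a b} → (a ≡ᵇ b) ≡ true → a ≡ b
≡ᵇ-true⇒≡ {a} {b} eq = ≡ᵇ⇒≡ a b (Equivalence.from T-≡ eq)

≡⇒≡ᵇ-true : ∀ {a b} → a ≡ b → (a ≡ᵇ b) ≡ true
≡⇒≡ᵇ-true {a} {b} a≡b = Equivalence.to T-≡ (≡⇒≡ᵇ a b a≡b)

≢⇒≡ᵇ-false : ∀ {a b} → a ≢ b → (a ≡ᵇ b) ≡ false
≢⇒≡ᵇ-false {a} {b} a≢b with a ≡ᵇ b in eq
... | true  = ⊥-elim (a≢b (≡ᵇ-true⇒≡ eq))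
... | false = refl

bit : Bool → ℕ
bit b = if b then 1 else 0

count : (ℕ → Bool) → ℕ → ℕ
count f zero    = 0
count f (suc n) = bit (f 0) + count (f ∘ suc) n

∣tabulate∣≡count : ∀ n (f : ℕ → Bool) → ∣ tabulate {n = n} (f ∘ toℕ) ∣ ≡ count f n
∣tabulate∣≡count zero    f = refl
∣tabulate∣≡count (suc n) f with f 0
... | true  = cong suc (∣tabulate∣≡count n (f ∘ suc))
... | false = ∣tabulate∣≡count n (f ∘ suc)

count-cong : ∀ n {f g} → (∀ i → i < n → f i ≡ g i) → count f n ≡ count g n
count-cong zero    f≡g = refl
count-cong (suc n) f≡g =
  cong₂ _+_ (cong bit (f≡g 0 (s≤s z≤n))) (count-cong n (λ i i<n → f≡g (suc i) (s≤s i<n)))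

count-mono : ∀ n {f g} → (∀ i → i < n → f i ≡ true → g i ≡ true) → count f n ≤ count g n
count-mono zero    f⇒g = z≤n
count-mono (suc n) {f} {g} f⇒g =
  +-mono-≤ (bit-mono (f 0) (g 0) (f⇒g 0 (s≤s z≤n)))
           (count-mono n (λ i i<n → f⇒g (suc i) (s≤s i<n)))
  where
  bit-mono : ∀ a b → (a ≡ true → b ≡ true) → bit a ≤ bit b
  bit-mono false b     _   = z≤n
  bit-mono true  true  _   = ≤-refl
  bit-mono true  false a⇒b = ⊥-elim (true≢false (sym (a⇒b refl)))

count-all : ∀ n {f} → (∀ i → i < n → f i ≡ true) → count f n ≡ n
count-all zero    _     = refl
count-all (suc n) {f} all-f with f 0 | all-f 0 (s≤s z≤n)
... | true | _ = cong suc (count-all n (λ i i<n → all-f (suc i) (s≤s i<n)))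

count-none : ∀ n {f} → (∀ i → i < n → f i ≡ false) → count f n ≡ 0
count-none zero    _    = refl
count-none (suc n) {f} none with f 0 | none 0 (s≤s z≤n)
... | false | _ = count-none n (λ i i<n → none (suc i) (s≤s i<n))

count-++ : ∀ a b f → count f (a + b) ≡ count f a + count (λ i → f (a + i)) b
count-++ zero    b f = refl
count-++ (suc a) b f =
  trans (cong (bit (f 0) +_) (count-++ a b (f ∘ suc))) (sym (+-assoc (bit (f 0)) _ _))

count-monoʳ : ∀ f {a b} → a ≤ b → count f a ≤ count f b
count-monoʳ f {a} {b} a≤b = begin
  count f a                                   ≤⟨ m≤m+n (count f a) _ ⟩
  count f a + count (λ i → f (a + i)) (b ∸ a) ≡⟨ count-++ a (b ∸ a) f ⟨
  count f (a + (b ∸ a))                       ≡⟨ cong (count f) (m+[n∸m]≡n a≤b) ⟩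
  count f b                                   ∎
  where open ≤-Reasoning

count-snoc : ∀ n f → count f (suc n) ≡ count f n + bit (f n)
count-snoc zero    f = +-comm (bit (f 0)) 0
count-snoc (suc n) f =
  trans (cong (bit (f 0) +_) (count-snoc n (f ∘ suc))) (sym (+-assoc (bit (f 0)) _ _))

count-reverse : ∀ n f → count f n ≡ count (λ i → f (n ∸ suc i)) n
count-reverse zero    f = refl
count-reverse (suc n) f = begin
  count f (suc n)                                ≡⟨ count-snoc n f ⟩
  count f n + bit (f n)                          ≡⟨ cong (_+ bit (f n)) (count-reverse n f) ⟩
  count (λ i → f (n ∸ suc i)) n + bit (f n)      ≡⟨ +-comm _ (bit (f n)) ⟩
  count (λ i → f (suc n ∸ suc i)) (suc n)        ∎
  where open ≡-Reasoning

count-interleave : ∀ m f →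
  count f (m * 2) ≡ count (λ d → f (d * 2)) m + count (λ d → f (suc (d * 2))) m
count-interleave zero    f = refl
count-interleave (suc m) f = begin
  b₀ + (b₁ + count (f ∘ suc ∘ suc) (m * 2))    ≡⟨ cong (λ k → b₀ + (b₁ + k)) (count-interleave m _) ⟩
  b₀ + (b₁ + (count evens m + count odds m))   ≡⟨ +-assoc b₀ b₁ _ ⟨
  (b₀ + b₁) + (count evens m + count odds m)   ≡⟨ interchange b₀ b₁ _ _ ⟩
  (b₀ + count evens m) + (b₁ + count odds m)   ∎
  where
  open ≡-Reasoning
  b₀ = bit (f 0)
  b₁ = bit (f 1)
  evens = λ d → f (suc d * 2)
  odds  = λ d → f (suc (suc d * 2))

count-≡ᵇ≤1 : ∀ a n → count (_≡ᵇ a) n ≤ 1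
count-≡ᵇ≤1 a       zero    = z≤n
count-≡ᵇ≤1 zero    (suc n) = ≤-reflexive (cong suc (count-none n (λ _ _ → refl)))
count-≡ᵇ≤1 (suc a) (suc n) = count-≡ᵇ≤1 a n

∣tabulate∘opposite∣≡count : ∀ n (f : ℕ → Bool) →
  ∣ tabulate {n = n} (f ∘ toℕ ∘ opposite) ∣ ≡ count f n
∣tabulate∘opposite∣≡count n f = begin
  ∣ tabulate {n = n} (f ∘ toℕ ∘ opposite) ∣          ≡⟨ cong ∣_∣ (tabulate-cong {n = n} (cong f ∘ opposite-prop)) ⟩
  ∣ tabulate {n = n} (λ x → f (n ∸ suc (toℕ x))) ∣ ≡⟨ ∣tabulate∣≡count n (λ i → f (n ∸ suc i)) ⟩
  count (λ i → f (n ∸ suc i)) n                    ≡⟨ count-reverse n f ⟨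
  count f n                                        ∎
  where open ≡-Reasoning

-- Forcing schedules

-- x is blue from round time x on, forced by forcer x when time x > 0.
record ForcingSchedule {n : ℕ} (Γ : Digraph n) (T : ℕ) : Set where
  field
    time           : Fin n → ℕ
    forcer         : Fin n → Fin n
    time≤T         : ∀ x → time x ≤ T
    forcer-arc     : ∀ x → 0 < time x → Γ (forcer x) x ≡ true
    forcer-earlier : ∀ x → 0 < time x → time (forcer x) < time x
    others-earlier : ∀ x → 0 < time x →
                     ∀ y → Γ (forcer x) y ≡ true → y ≢ x → time y < time x
    forced-on-time : ∀ x → 0 < time x → time x ≡ 1 ⊎
                     ∃ λ y → Γ (forcer x) y ≡ true × y ≢ x × suc (time y) ≡ time x

infix 4 _≐_

_≐_ : ∀ {n} → Subset n → (Fin n → Set) → Set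
S ≐ P = ∀ x → x ∈ S ⇔ P x

≐-resp : ∀ {n} {S : Subset n} {P Q : Fin n → Set} → S ≐ P → (∀ x → P x ⇔ Q x) → S ≐ Q
≐-resp S≐P P⇔Q x = ⇔.trans (S≐P x) (P⇔Q x)

⁅⁆∪-≐ : ∀ {n} {S : Subset n} {P : Fin n → Set} w → S ≐ P → ⁅ w ⁆ ∪ S ≐ (λ x → x ≡ w ⊎ P x)
⁅⁆∪-≐ w S≐P x = ⇔.trans ∪⇔⊎ (x∈⁅y⁆⇔x≡y ⊎-⇔ S≐P x)

∈-tabulate : ∀ {n} (f : Fin n → Bool) x → x ∈ tabulate f ⇔ f x ≡ true
∈-tabulate f x = mk⇔
  (λ x∈ → trans (sym (lookup∘tabulate f x)) ([]=⇒lookup x∈))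
  (λ fx → lookup⇒[]= x (tabulate f) (trans (lookup∘tabulate f x) fx))

≡ᵇ0⇔<1 : ∀ k → (k ≡ᵇ 0) ≡ true ⇔ k < 1
≡ᵇ0⇔<1 zero    = mk⇔ (λ _ → s≤s z≤n) (λ _ → refl)
≡ᵇ0⇔<1 (suc k) = mk⇔ (λ ()) (λ { (s≤s ()) })

ValidSeq-++ : ∀ {n} {Γ : Digraph n} {S} (xs ys : List (Force n)) →
              ValidSeq Γ S xs → ValidSeq Γ (after S xs) ys → ValidSeq Γ S (xs ++ ys)
ValidSeq-++ []             ys _         vys = vys
ValidSeq-++ ((u , w) ∷ xs) ys (c , vxs) vys = c , ValidSeq-++ xs ys vxs vys

after-++ : ∀ {n} S (xs ys : List (Force n)) → after S (xs ++ ys) ≡ after (after S xs) ys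
after-++ S []             ys = refl
after-++ S ((u , w) ∷ xs) ys = after-++ (⁅ w ⁆ ∪ S) xs ys

module _ {n : ℕ} {Γ : Digraph n} {T : ℕ} (S : ForcingSchedule Γ T) where
  open ForcingSchedule S
  open Equivalence

  initial : Subset n
  initial = tabulate (λ x → time x ≡ᵇ 0)

  initial≐ : initial ≐ (λ x → time x < 1)
  initial≐ x = ⇔.trans (∈-tabulate (λ x → time x ≡ᵇ 0) x) (≡ᵇ0⇔<1 (time x))

  force : Fin n → Force n
  force x = forcer x , x

  scheduledAt : ℕ → List (Fin n)
  scheduledAt t = filter (λ x → time x ≟ t) (allFin n)

  forcesFrom : ℕ → ℕ → List (Force n)
  forcesFrom t zero    = []
  forcesFrom t (suc k) = map force (scheduledAt t) ++ forcesFrom (suc t) k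

  forces : List (Force n)
  forces = forcesFrom 1 T

  ∈-forcesFrom⁻ : ∀ k t {u x} → (u , x) ∈ₗ forcesFrom t k → u ≡ forcer x × t ≤ time x
  ∈-forcesFrom⁻ (suc k) t u→x with ∈-++⁻ (map force (scheduledAt t)) u→x
  ... | inj₂ later = Product.map₂ (≤-trans (n≤1+n t)) (∈-forcesFrom⁻ k (suc t) later)
  ... | inj₁ now with ∈-map⁻ force now
  ...   | x , x∈ , refl =
    refl , ≤-reflexive (sym (proj₂ (∈-filter⁻ (λ x → time x ≟ t) {xs = allFin n} x∈)))

  ∈-forcesFrom⁺ : ∀ k t {x} → t ≤ time x → time x < t + k → force x ∈ₗ forcesFrom t k
  ∈-forcesFrom⁺ zero    t t≤tx tx<t+0 =
    ⊥-elim (<⇒≱ tx<t+0 (subst (_≤ _) (sym (+-identityʳ t)) t≤tx))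
  ∈-forcesFrom⁺ (suc k) t {x} t≤tx tx<t+k with m≤n⇒m<n∨m≡n t≤tx
  ... | inj₂ refl = ∈-++⁺ˡ (∈-map⁺ force (∈-filter⁺ (λ x → time x ≟ t) (∈-allFin x) refl))
  ... | inj₁ t<tx = ∈-++⁺ʳ (map force (scheduledAt t))
                      (∈-forcesFrom⁺ k (suc t) t<tx (subst (time x <_) (+-suc t k) tx<t+k))

  BlueInRound : ℕ → List (Fin n) → Fin n → Set
  BlueInRound t l y = time y < t ⊎ (time y ≡ t × y ∉ₗ l)

  BlueInRound-∷ : ∀ {t x l} → time x ≡ t → x ∉ₗ l →
                  ∀ y → (y ≡ x ⊎ BlueInRound t (x ∷ l) y) ⇔ BlueInRound t l y
  BlueInRound-∷ {t} {x} {l} tx x∉l y = mk⇔ to′ from′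
    where
    to′ : y ≡ x ⊎ BlueInRound t (x ∷ l) y → BlueInRound t l y
    to′ (inj₁ refl)              = inj₂ (tx , x∉l)
    to′ (inj₂ (inj₁ ty<t))       = inj₁ ty<t
    to′ (inj₂ (inj₂ (ty , y∉))) = inj₂ (ty , y∉ ∘ there)
    from′ : BlueInRound t l y → y ≡ x ⊎ BlueInRound t (x ∷ l) y
    from′ (inj₁ ty<t) = inj₂ (inj₁ ty<t)
    from′ (inj₂ (ty , y∉l)) with y ≟ᶠ x
    ... | yes y≡x = inj₁ y≡x
    ... | no  y≢x = inj₂ (inj₂ (ty , λ { (here y≡x) → y≢x y≡x ; (there y∈l) → y∉l y∈l }))

  round-valid : ∀ t l B → 0 < t → Unique l → All (λ x → time x ≡ t) l →
                B ≐ BlueInRound t l →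
                ValidSeq Γ B (map force l) × after B (map force l) ≐ BlueInRound t []
  round-valid t []      B _   _                 _          B≐ = tt , B≐
  round-valid t (x ∷ l) B 0<t (x≢l ∷ unique-l) (tx ∷ txs) B≐ =
    (canForce , proj₁ rest) , proj₂ rest
    where
    0<tx : 0 < time x
    0<tx = subst (0 <_) (sym tx) 0<t
    x∉l : x ∉ₗ l
    x∉l x∈l = All.lookup x≢l x∈l refl
    blue : ∀ y → time y < time x → y ∈ B
    blue y ty<tx = from (B≐ y) (inj₁ (subst (time y <_) tx ty<tx))
    x∉B : x ∉ B
    x∉B x∈B with to (B≐ x) x∈B
    ... | inj₁ tx<t     = <-irrefl tx tx<t
    ... | inj₂ (_ , x∉) = x∉ (here refl)
    onlyWhite : ∀ y → Γ (forcer x) y ≡ true → y ∉ B → y ≡ x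
    onlyWhite y fy y∉B with y ≟ᶠ x
    ... | yes y≡x = y≡x
    ... | no  y≢x = ⊥-elim (y∉B (blue y (others-earlier x 0<tx y fy y≢x)))
    canForce : CanForce Γ B (forcer x) x
    canForce = blue (forcer x) (forcer-earlier x 0<tx) , x∉B , forcer-arc x 0<tx , onlyWhite
    rest = round-valid t l (⁅ x ⁆ ∪ B) 0<t unique-l txs
             (≐-resp (⁅⁆∪-≐ x B≐) (BlueInRound-∷ tx x∉l))

  round-start : ∀ t y → time y < t ⇔ BlueInRound t (scheduledAt t) y
  round-start t y = mk⇔ inj₁ λ
    { (inj₁ ty<t)      → ty<t
    ; (inj₂ (ty , y∉)) → ⊥-elim (y∉ (∈-filter⁺ (λ x → time x ≟ t) (∈-allFin y) ty)) }

  round-end : ∀ t y → BlueInRound t [] y ⇔ time y < suc t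
  round-end t y = mk⇔
    (λ { (inj₁ ty<t) → m≤n⇒m≤1+n ty<t ; (inj₂ (ty , _)) → s≤s (≤-reflexive ty) })
    (λ ty≤t → Sum.map₂ (_, λ ()) (m≤n⇒m<n∨m≡n (≤-pred ty≤t)))

  forcesFrom-valid : ∀ k t B → 0 < t → B ≐ (λ y → time y < t) →
    ValidSeq Γ B (forcesFrom t k) × after B (forcesFrom t k) ≐ (λ y → time y < t + k)
  forcesFrom-valid zero    t B _   B≐ =
    tt , subst (λ s → B ≐ (λ y → time y < s)) (sym (+-identityʳ t)) B≐
  forcesFrom-valid (suc k) t B 0<t B≐ =
    ValidSeq-++ now (forcesFrom (suc t) k) (proj₁ round) (proj₁ later) ,
    subst₂ (λ C s → C ≐ (λ y → time y < s))
      (sym (after-++ B now (forcesFrom (suc t) k))) (sym (+-suc t k)) (proj₂ later)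
    where
    now = map force (scheduledAt t)
    round = round-valid t (scheduledAt t) B 0<t (filter⁺ (λ x → time x ≟ t) (allFin⁺ n))
              (all-filter (λ x → time x ≟ t) (allFin n)) (≐-resp B≐ (round-start t))
    later = forcesFrom-valid k (suc t) _ (s≤s z≤n) (≐-resp (proj₂ round) (round-end t))

  forces-valid : ValidSeq Γ initial forces × after initial forces ≐ (λ y → time y < suc T)
  forces-valid = forcesFrom-valid T 1 initial (s≤s z≤n) initial≐

  forces-isForceSet : IsForceSetOf Γ initial forces
  forces-isForceSet = forces , ↭-refl , proj₁ forces-valid ,
    λ u w (_ , w∉ , _) → w∉ (from (proj₂ forces-valid w) (s≤s (time≤T w)))

  round⇒time≤ : ∀ t x → Round Γ initial forces t x → time x ≤ t
  round⇒time≤ zero    x x∈B      = ≤-pred (to (initial≐ x) x∈B)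
  round⇒time≤ (suc t) x (inj₁ r) = m≤n⇒m≤1+n (round⇒time≤ t x r)
  round⇒time≤ (suc t) x (inj₂ (_ , u , u→x , _ , _ , onlyWhite))
    with ∈-forcesFrom⁻ T 1 u→x
  ... | refl , 0<tx with forced-on-time x 0<tx
  ...   | inj₁ tx≡1                = ≤-trans (≤-reflexive tx≡1) (s≤s z≤n)
  ...   | inj₂ (y , fy , y≢x , ty) = subst (_≤ suc t) ty (s≤s ty≤t)
    where
    ty≤t : time y ≤ t
    ty≤t with time y ≤? t
    ... | yes ty≤t = ty≤t
    ... | no  ty≰t = ⊥-elim (y≢x (onlyWhite y fy (ty≰t ∘ round⇒time≤ t y)))

  time≤⇒round : ∀ t x → time x ≤ t → Round Γ initial forces t x
  time≤⇒round zero    x tx≤0   = from (initial≐ x) (s≤s tx≤0)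
  time≤⇒round (suc t) x tx≤1+t with m≤n⇒m<n∨m≡n tx≤1+t
  ... | inj₁ tx≤t = inj₁ (time≤⇒round t x (≤-pred tx≤t))
  ... | inj₂ tx   = inj₂ (notYet , forcer x , ∈-forcesFrom⁺ T 1 0<tx (s≤s (time≤T x)) ,
                          time≤⇒round t (forcer x) forcerReady , forcer-arc x 0<tx , onlyWhite)
    where
    0<tx : 0 < time x
    0<tx = subst (0 <_) (sym tx) (s≤s z≤n)
    notYet : ¬ Round Γ initial forces t x
    notYet r = 1+n≰n (subst (_≤ t) tx (round⇒time≤ t x r))
    forcerReady : time (forcer x) ≤ t
    forcerReady = ≤-pred (subst (time (forcer x) <_) tx (forcer-earlier x 0<tx))
    onlyWhite : ∀ y → Γ (forcer x) y ≡ true → ¬ Round Γ initial forces t y → y ≡ x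
    onlyWhite y fy ¬r with y ≟ᶠ x
    ... | yes y≡x = y≡x
    ... | no  y≢x = ⊥-elim (¬r (time≤⇒round t y
                      (≤-pred (subst (time y <_) tx (others-earlier x 0<tx y fy y≢x)))))

  schedule⇒throttling : ThrottlingAtMost Γ (∣ initial ∣ + T)
  schedule⇒throttling =
    initial , forces , T , forces-isForceSet , (λ x → time≤⇒round T x (time≤T x)) , ≤-refl

ThrottlingAtMost-mono : ∀ {n} {Γ : Digraph n} {k k′} → k ≤ k′ →
                        ThrottlingAtMost Γ k → ThrottlingAtMost Γ k′
ThrottlingAtMost-mono k≤k′ (B , F , t , forceSet , done , B+t≤k) =
  B , F , t , forceSet , done , ≤-trans B+t≤k k≤k′

schedule-relabel : ∀ {n T} {Γ : Digraph n} (π : Fin n → Fin n) → (∀ x → π (π x) ≡ x) →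
                   ForcingSchedule (λ u w → Γ (π u) (π w)) T → ForcingSchedule Γ T
schedule-relabel {Γ = Γ} π π∘π S = record
  { time           = time ∘ π
  ; forcer         = π ∘ forcer ∘ π
  ; time≤T         = time≤T ∘ π
  ; forcer-arc     = λ x 0<tx →
      subst (λ v → Γ (π (forcer (π x))) v ≡ true) (π∘π x) (forcer-arc (π x) 0<tx)
  ; forcer-earlier = λ x 0<tx →
      subst (λ v → time v < time (π x)) (sym (π∘π _)) (forcer-earlier (π x) 0<tx)
  ; others-earlier = λ x 0<tx y fy y≢x →
      others-earlier (π x) 0<tx (π y) (subst (λ v → Γ _ v ≡ true) (sym (π∘π y)) fy)
        (y≢x ∘ π-injective)
  ; forced-on-time = λ x 0<tx → Sum.map₂
      (λ { (y , fy , y≢πx , ty) →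
           π y , fy , (λ πy≡x → y≢πx (trans (sym (π∘π y)) (cong π πy≡x))) ,
           subst (λ v → suc (time v) ≡ _) (sym (π∘π y)) ty })
      (forced-on-time (π x) 0<tx)
  }
  where
  open ForcingSchedule S
  π-injective : ∀ {x y} → π x ≡ π y → x ≡ y
  π-injective {x} {y} πx≡πy = trans (sym (π∘π x)) (trans (cong π πx≡πy) (π∘π y))

-- Alternating paths

Adjacent : ℕ → ℕ → Set
Adjacent a b = b ≡ suc a ⊎ a ≡ suc b

IsSource IsSink : ∀ {n} → Digraph n → Fin n → Set
IsSource Γ v = ∀ u → Γ u v ≡ false
IsSink   Γ v = ∀ w → Γ v w ≡ false

opposite-step : ∀ {n} (i j : Fin n) →
                toℕ (opposite j) ≡ suc (toℕ (opposite i)) → toℕ i ≡ suc (toℕ j)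
opposite-step {n} i j eq = suc-injective (+-cancelˡ-≡ x _ _ (sym (begin
  x + suc (suc (toℕ j))                ≡⟨ +-suc x (suc (toℕ j)) ⟩
  suc x + suc (toℕ j)                  ≡⟨ cong (λ y → suc y + suc (toℕ j)) (opposite-prop i) ⟨
  suc (toℕ (opposite i)) + suc (toℕ j) ≡⟨ cong (_+ suc (toℕ j)) eq ⟨
  toℕ (opposite j) + suc (toℕ j)       ≡⟨ cong (_+ suc (toℕ j)) (opposite-prop j) ⟩
  n ∸ suc (toℕ j) + suc (toℕ j)        ≡⟨ m∸n+n≡m (toℕ<n j) ⟩
  n                                    ≡⟨ m∸n+n≡m (toℕ<n i) ⟨
  x + suc (toℕ i)                      ∎)))
  where
  open ≡-Reasoning
  x = n ∸ suc (toℕ i)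

reverse-alternatingPath : ∀ {n} {Γ : Digraph n} → IsAlternatingPath Γ →
                          IsAlternatingPath (λ u w → Γ (opposite u) (opposite w))
reverse-alternatingPath {Γ = Γ} ((adjacent , oriented) , alternating) =
  (adjacent′ , oriented′) , alternating′
  where
  adjacent′ : ∀ i j → Γ (opposite i) (opposite j) ≡ true →
              toℕ j ≡ suc (toℕ i) ⊎ toℕ i ≡ suc (toℕ j)
  adjacent′ i j arc = Sum.swap (Sum.map (opposite-step i j) (opposite-step j i)
                                        (adjacent (opposite i) (opposite j) arc))
  oriented′ : ∀ i j → toℕ j ≡ suc (toℕ i) → _
  oriented′ i j j≡1+i = Sum.swap (Sum.map Product.swap Product.swap
    (oriented (opposite j) (opposite i) (opposite-step (opposite i) (opposite j)
      (subst₂ (λ a b → toℕ a ≡ suc (toℕ b)) (sym (opposite-involutive j))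
              (sym (opposite-involutive i)) j≡1+i))))
  alternating′ : IsAlternating (λ u w → Γ (opposite u) (opposite w))
  alternating′ v = Sum.map (λ noIn → noIn ∘ opposite) (λ noOut → noOut ∘ opposite)
                           (alternating (opposite v))

module _ {n} {Γ : Digraph n} (path : IsAlternatingPath Γ) where
  private
    oriented    = proj₂ (proj₁ path)
    alternating = proj₂ path

  arc⇒adjacent : ∀ {u w} → Γ u w ≡ true → Adjacent (toℕ u) (toℕ w)
  arc⇒adjacent = proj₁ (proj₁ path) _ _

  adjacent⇒arc : ∀ {u w} → Adjacent (toℕ u) (toℕ w) → Γ u w ≡ true ⊎ Γ w u ≡ true
  adjacent⇒arc {u} {w} (inj₁ w≡1+u) = Sum.map proj₁ proj₂ (oriented u w w≡1+u)
  adjacent⇒arc {u} {w} (inj₂ u≡1+w) = Sum.swap (Sum.map proj₁ proj₂ (oriented w u u≡1+w))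

  inArc⇒sink : ∀ {u v} → Γ u v ≡ true → IsSink Γ v
  inArc⇒sink {u} {v} arc with alternating v
  ... | inj₁ noIn = ⊥-elim (true≢false (trans (sym arc) (noIn u)))
  ... | inj₂ sink = sink

  outArc⇒source : ∀ {v w} → Γ v w ≡ true → IsSource Γ v
  outArc⇒source {v} {w} arc with alternating v
  ... | inj₁ source = source
  ... | inj₂ noOut  = ⊥-elim (true≢false (trans (sym arc) (noOut w)))

  source-arc : ∀ {u w} → IsSource Γ u → Adjacent (toℕ u) (toℕ w) → Γ u w ≡ true
  source-arc {u} {w} source adj with adjacent⇒arc adj
  ... | inj₁ arc = arc
  ... | inj₂ arc = ⊥-elim (true≢false (trans (sym arc) (source w)))

  source-next : ∀ {u w} → toℕ w ≡ suc (toℕ u) → IsSource Γ u → IsSink Γ w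
  source-next w≡1+u source = inArc⇒sink (source-arc source (inj₁ w≡1+u))

  sink-next : ∀ {u w} → toℕ w ≡ suc (toℕ u) → IsSink Γ u → IsSource Γ w
  sink-next {u} {w} w≡1+u sink with adjacent⇒arc (inj₁ w≡1+u)
  ... | inj₁ arc = ⊥-elim (true≢false (trans (sym arc) (sink w)))
  ... | inj₂ arc = outArc⇒source arc

predecessor : ∀ {n a} (v : Fin n) → toℕ v ≡ suc a → ∃ λ u → toℕ u ≡ a
predecessor {n} {a} v v≡1+a = fromℕ< a<n , toℕ-fromℕ< a<n
  where
  a<n : a < n
  a<n = <-trans (n<1+n a) (subst (_< n) v≡1+a (toℕ<n v))

module _ {n} {A B : Fin n → Set}
         (A→B : ∀ {u w} → toℕ w ≡ suc (toℕ u) → A u → B w)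
         (B→A : ∀ {u w} → toℕ w ≡ suc (toℕ u) → B u → A w)
         (first : ∀ v → toℕ v ≡ 0 → A v) where

  typeAtEven : ∀ d v → toℕ v ≡ d * 2 → A v
  typeAtOdd  : ∀ d v → toℕ v ≡ suc (d * 2) → B v

  typeAtEven zero    v v≡0 = first v v≡0
  typeAtEven (suc d) v v≡  with predecessor v v≡
  ... | u , u≡ = B→A (trans v≡ (cong suc (sym u≡))) (typeAtOdd d u u≡)
  typeAtOdd d v v≡ with predecessor v v≡
  ... | u , u≡ = A→B (trans v≡ (cong suc (sym u≡))) (typeAtEven d u u≡)

-- Blue spreading along the sinks

%-suc : ∀ d n .{{_ : NonZero n}} → suc (d % n) < n → suc d % n ≡ suc (d % n)
%-suc d n 1+r<n = begin
  suc d % n                       ≡⟨ cong (λ k → suc k % n) (m≡m%n+[m/n]*n d n) ⟩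
  (suc (d % n) + d / n * n) % n   ≡⟨ [m+kn]%n≡m%n (suc (d % n)) (d / n) n ⟩
  suc (d % n) % n                 ≡⟨ m<n⇒m%n≡m 1+r<n ⟩
  suc (d % n)                     ∎
  where open ≡-Reasoning

%-suc-wrap : ∀ d n .{{_ : NonZero n}} → suc (d % n) ≡ n → suc d % n ≡ 0
%-suc-wrap d n 1+r≡n = begin
  suc d % n                       ≡⟨ cong (λ k → suc k % n) (m≡m%n+[m/n]*n d n) ⟩
  (suc (d % n) + d / n * n) % n   ≡⟨ cong (λ k → (k + d / n * n) % n) 1+r≡n ⟩
  suc (d / n) * n % n             ≡⟨ m*n%n≡0 (suc (d / n)) n ⟩
  0                               ∎
  where open ≡-Reasoning

∸-suc : ∀ {a b} → a < b → b ∸ a ≡ suc (b ∸ suc a)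
∸-suc a<b = +-∸-assoc 1 a<b

-- Sink d of m sinks in a row is reached in m - d rounds from the end beyond sink m - 1, and
-- in phase d rounds from the nearest initially blue sink, those being the d with
-- d % period ≡ T.
module SinkSchedule (m T : ℕ) where

  period : ℕ
  period = suc (T + T)

  phase : ℕ → ℕ
  phase d = ∣ d % period - T ∣

  sinkTime : ℕ → ℕ
  sinkTime d = (m ∸ d) ⊓ phase d

  phase-below : ∀ d → d % period < T → suc (phase (suc d)) ≡ phase d
  phase-below d r<T = begin
    suc ∣ suc d % period - T ∣   ≡⟨ cong (λ r → suc ∣ r - T ∣) (%-suc d period 1+r<period) ⟩
    suc ∣ suc (d % period) - T ∣ ≡⟨ cong suc (m≤n⇒∣m-n∣≡n∸m r<T) ⟩
    suc (T ∸ suc (d % period))   ≡⟨ ∸-suc r<T ⟨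
    T ∸ d % period               ≡⟨ m≤n⇒∣m-n∣≡n∸m (<⇒≤ r<T) ⟨
    ∣ d % period - T ∣           ∎
    where
    open ≡-Reasoning
    1+r<period : suc (d % period) < period
    1+r<period = s≤s (≤-trans r<T (m≤m+n T T))

  phase-above : ∀ d → T < suc d % period → suc (phase d) ≡ phase (suc d)
  phase-above d T<r′ with m≤n⇒m<n∨m≡n (m%n<n d period)
  ... | inj₂ wrap = ⊥-elim (<⇒≱ T<r′ (subst (_≤ T) (sym (%-suc-wrap d period wrap)) z≤n))
  ... | inj₁ 1+r<period = begin
    suc ∣ d % period - T ∣       ≡⟨ cong suc (m≤n⇒∣n-m∣≡n∸m T≤r) ⟩
    suc (d % period ∸ T)         ≡⟨ +-∸-assoc 1 T≤r ⟨
    suc (d % period) ∸ T         ≡⟨ m≤n⇒∣n-m∣≡n∸m (m≤n⇒m≤1+n T≤r) ⟨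
    ∣ suc (d % period) - T ∣     ≡⟨ cong (λ r → ∣ r - T ∣) (%-suc d period 1+r<period) ⟨
    ∣ suc d % period - T ∣       ∎
    where
    open ≡-Reasoning
    T≤r : T ≤ d % period
    T≤r = ≤-pred (subst (T <_) (%-suc d period 1+r<period) T<r′)

  phase≤T : ∀ d → phase d ≤ T
  phase≤T d with ∣m-n∣≡[m∸n]∨[n∸m] (d % period) T
  ... | inj₁ eq = begin
    ∣ d % period - T ∣ ≡⟨ eq ⟩
    d % period ∸ T     ≤⟨ ∸-monoˡ-≤ T (≤-pred (m%n<n d period)) ⟩
    T + T ∸ T          ≡⟨ m+n∸m≡n T T ⟩
    T                  ∎
    where open ≤-Reasoning
  ... | inj₂ eq = ≤-trans (≤-reflexive eq) (m∸n≤m T (d % period))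

  phase-suc : ∀ d → phase d ≤ suc (phase (suc d))
  phase-suc d with d % period <? T | m≤n⇒m<n∨m≡n (m%n<n d period)
  ... | yes r<T | _ = ≤-reflexive (sym (phase-below d r<T))
  ... | no  r≮T | inj₁ 1+r<period = begin
    phase d             ≤⟨ n≤1+n (phase d) ⟩
    suc (phase d)       ≡⟨ phase-above d T<r′ ⟩
    phase (suc d)       ≤⟨ n≤1+n (phase (suc d)) ⟩
    suc (phase (suc d)) ∎
    where
    open ≤-Reasoning
    T<r′ : T < suc d % period
    T<r′ = subst (T <_) (sym (%-suc d period 1+r<period)) (s≤s (≮⇒≥ r≮T))
  ... | no  r≮T | inj₂ wrap = begin
    phase d ≤⟨ phase≤T d ⟩
    T       ≤⟨ n≤1+n T ⟩
    suc ∣ 0 - T ∣ ≡⟨ cong (λ r → suc ∣ r - T ∣) (%-suc-wrap d period wrap) ⟨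
    suc (phase (suc d)) ∎
    where open ≤-Reasoning

  sinkTime≤T : ∀ d → sinkTime d ≤ T
  sinkTime≤T d = ≤-trans (m⊓n≤n (m ∸ d) (phase d)) (phase≤T d)

  sinkTime-end : sinkTime m ≡ 0
  sinkTime-end = cong (_⊓ phase m) (n∸n≡0 m)

  sinkTime≡phase : ∀ d → phase d ≤ m ∸ d → sinkTime d ≡ phase d
  sinkTime≡phase d = m≥n⇒m⊓n≡n

  sinkTime≡0 : ∀ {d} → d < m → sinkTime d ≡ 0 → d % period ≡ T
  sinkTime≡0 {d} d<m s≡0 with m ∸ d ≤? phase d
  ... | yes reach = ⊥-elim (m>n⇒m∸n≢0 d<m (trans (sym (m≤n⇒m⊓n≡m reach)) s≡0))
  ... | no ¬reach = ∣m-n∣≡0⇒m≡n (trans (sym (sinkTime≡phase d (<⇒≤ (≰⇒> ¬reach)))) s≡0)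

  LeftStep : ℕ → Set
  LeftStep zero    = ⊥
  LeftStep (suc d) = suc (sinkTime d) ≡ sinkTime (suc d)

  leftStep? : ∀ d → Dec (LeftStep d)
  leftStep? zero    = no (λ ())
  leftStep? (suc d) = suc (sinkTime d) ≟ sinkTime (suc d)

  leftStep : ∀ d → phase d < m ∸ d → T < d % period → LeftStep d
  leftStep zero    _     T<0 = ⊥-elim (n≮0 T<0)
  leftStep (suc d) ahead T<r = begin
    suc (sinkTime d)   ≡⟨ cong suc (sinkTime≡phase d (<⇒≤ behind)) ⟩
    suc (phase d)      ≡⟨ phase-above d T<r ⟩
    phase (suc d)      ≡⟨ sinkTime≡phase (suc d) (<⇒≤ ahead) ⟨
    sinkTime (suc d)   ∎
    where
    open ≡-Reasoning
    behind : phase d < m ∸ d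
    behind = ≤-trans (≤-reflexive (phase-above d T<r))
               (≤-trans (<⇒≤ ahead) (∸-monoʳ-≤ m (n≤1+n d)))

  rightStep : ∀ {d} → d < m → 0 < sinkTime d → ¬ LeftStep d →
              suc (sinkTime (suc d)) ≡ sinkTime d
  rightStep {d} d<m 0<s ¬left with m ∸ d ≤? phase d
  ... | yes reach = begin
    suc (sinkTime (suc d)) ≡⟨ cong suc (m≤n⇒m⊓n≡m reach′) ⟩
    suc (m ∸ suc d)        ≡⟨ ∸-suc d<m ⟨
    m ∸ d                  ≡⟨ m≤n⇒m⊓n≡m reach ⟨
    sinkTime d             ∎
    where
    open ≡-Reasoning
    reach′ : m ∸ suc d ≤ phase (suc d)
    reach′ = ≤-pred (≤-trans (≤-reflexive (sym (∸-suc d<m))) (≤-trans reach (phase-suc d)))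
  ... | no ¬reach with d % period <? T
  ...   | yes r<T = begin
    suc (sinkTime (suc d)) ≡⟨ cong suc (sinkTime≡phase (suc d) ahead′) ⟩
    suc (phase (suc d))    ≡⟨ phase-below d r<T ⟩
    phase d                ≡⟨ sinkTime≡phase d (<⇒≤ (≰⇒> ¬reach)) ⟨
    sinkTime d             ∎
    where
    open ≡-Reasoning
    ahead′ : phase (suc d) ≤ m ∸ suc d
    ahead′ = ≤-trans (n≤1+n _) (≤-trans (≤-reflexive (phase-below d r<T))
               (≤-pred (subst (phase d <_) (∸-suc d<m) (≰⇒> ¬reach))))
  ...   | no  r≮T = ⊥-elim (¬left (leftStep d (≰⇒> ¬reach) T<r))
    where
    T<r : T < d % period
    T<r = ≤∧≢⇒< (≮⇒≥ r≮T) λ T≡r → <⇒≢ 0<s (sym (begin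
      sinkTime d         ≡⟨ sinkTime≡phase d (<⇒≤ (≰⇒> ¬reach)) ⟩
      ∣ d % period - T ∣ ≡⟨ cong (λ r → ∣ r - T ∣) T≡r ⟨
      ∣ T - T ∣          ≡⟨ ∣n-n∣≡0 T ⟩
      0                  ∎))
      where open ≡-Reasoning

  count-phase≡T : ∀ q → count (λ d → d % period ≡ᵇ T) (T + q * period) ≤ q
  count-phase≡T zero = ≤-reflexive (count-none (T + 0) notCentre)
    where
    notCentre : ∀ i → i < T + 0 → (i % period ≡ᵇ T) ≡ false
    notCentre i i<T+0 = ≢⇒≡ᵇ-false (λ i%p≡T → <⇒≢ i<T (trans (sym (m<n⇒m%n≡m i<period)) i%p≡T))
      where
      i<T : i < T
      i<T = subst (i <_) (+-identityʳ T) i<T+0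
      i<period : i < period
      i<period = ≤-trans i<T (≤-trans (m≤m+n T T) (n≤1+n _))
  count-phase≡T (suc q) = begin
    count centre (T + (period + q * period))
      ≡⟨ cong (count centre) (x∙yz≈y∙xz T period (q * period)) ⟩
    count centre (period + (T + q * period))
      ≡⟨ count-++ period (T + q * period) centre ⟩
    count centre period + count (λ i → centre (period + i)) (T + q * period)
      ≡⟨ cong (count centre period +_) (count-cong (T + q * period) (λ i _ → cong (_≡ᵇ T) (periodic i))) ⟩
    count centre period + count centre (T + q * period)
      ≤⟨ +-mono-≤ oneBlock (count-phase≡T q) ⟩
    suc q ∎
    where
    open ≤-Reasoning
    centre : ℕ → Bool
    centre d = d % period ≡ᵇ T
    periodic : ∀ i → (period + i) % period ≡ i % period
    periodic i = trans (cong (_% period) (+-comm period i)) ([m+n]%n≡m%n i period)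
    oneBlock : count centre period ≤ 1
    oneBlock = ≤-trans (≤-reflexive (count-cong period (λ i i<p → cong (_≡ᵇ T) (m<n⇒m%n≡m i<p))))
                       (count-≡ᵇ≤1 T period)

  count-sinkZeros : ∀ q → m ≤ T + q * period → count (λ d → sinkTime d ≡ᵇ 0) m ≤ q
  count-sinkZeros q covered = begin
    count (λ d → sinkTime d ≡ᵇ 0) m
      ≤⟨ count-mono m (λ d d<m z → ≡⇒≡ᵇ-true (sinkTime≡0 d<m (≡ᵇ-true⇒≡ z))) ⟩
    count (λ d → d % period ≡ᵇ T) m
      ≤⟨ count-monoʳ (λ d → d % period ≡ᵇ T) covered ⟩
    count (λ d → d % period ≡ᵇ T) (T + q * period)
      ≤⟨ count-phase≡T q ⟩
    q ∎
    where open ≤-Reasoning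

onEven : (ℕ → ℕ) → ℕ → ℕ
onEven s zero          = s 0
onEven s (suc zero)    = 0
onEven s (suc (suc e)) = onEven (s ∘ suc) e

onEven-even : ∀ s d → onEven s (d * 2) ≡ s d
onEven-even s zero    = refl
onEven-even s (suc d) = onEven-even (s ∘ suc) d

onEven-odd : ∀ s d → onEven s (suc (d * 2)) ≡ 0
onEven-odd s zero    = refl
onEven-odd s (suc d) = onEven-odd (s ∘ suc) d

onEven-pos⇒even : ∀ s e → 0 < onEven s e → ∃ λ d → e ≡ d * 2
onEven-pos⇒even s zero          _ = 0 , refl
onEven-pos⇒even s (suc (suc e)) p with onEven-pos⇒even (s ∘ suc) e p
... | d , refl = suc d , refl

onEven-≤ : ∀ s {b} → (∀ d → s d ≤ b) → ∀ e → onEven s e ≤ b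
onEven-≤ s s≤b zero          = s≤b 0
onEven-≤ s s≤b (suc zero)    = z≤n
onEven-≤ s s≤b (suc (suc e)) = onEven-≤ (s ∘ suc) (s≤b ∘ suc) e

count-onEven-zeros : ∀ m s →
  count (λ e → onEven s e ≡ᵇ 0) (m * 2) ≡ count (λ d → s d ≡ᵇ 0) m + m
count-onEven-zeros m s = trans (count-interleave m _) (cong₂ _+_
  (count-cong m (λ d _ → cong (_≡ᵇ 0) (onEven-even s d)))
  (count-all m (λ d _ → cong (_≡ᵇ 0) (onEven-odd s d))))

⌊d*2/2⌋≡d : ∀ d → ⌊ d * 2 /2⌋ ≡ d
⌊d*2/2⌋≡d zero    = refl
⌊d*2/2⌋≡d (suc d) = cong suc (⌊d*2/2⌋≡d d)

odd<*2 : ∀ {d m} → d < m → suc (d * 2) < m * 2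
odd<*2 d<m = *-monoˡ-≤ 2 d<m

even<*2 : ∀ {d m} → d < m → d * 2 < m * 2
even<*2 d<m = <-trans (n<1+n _) (odd<*2 d<m)

-- The path with vertices 0, …, 2m - 1 has its sinks at the even positions 2d and its
-- sources at the odd positions; sink d is forced from the source 2d - 1 or 2d + 1.
module NormalSchedule (m T : ℕ) where
  open SinkSchedule m T

  sourceOf : ℕ → ℕ
  sourceOf d = if does (leftStep? d) then d * 2 ∸ 1 else suc (d * 2)

  -- the source at position p forces sink d in round sinkTime d
  record ForcedFrom (d p : ℕ) : Set where
    field
      source   : ∃ λ c → p ≡ suc (c * 2)
      p<2m     : p < m * 2
      adjacent : Adjacent p (d * 2)
      previous : ∀ o → Adjacent p o → o ≢ d * 2 →
                 ∃ λ d′ → o ≡ d′ * 2 × suc (sinkTime d′) ≡ sinkTime d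
      tight    : sinkTime d ≡ 1 ⊎ ∃ λ o → o < m * 2 × Adjacent p o × o ≢ d * 2

  forcedFrom-left : ∀ d → d < m → LeftStep d → ForcedFrom d (d * 2 ∸ 1)
  forcedFrom-left (suc d) d<m left = record
    { source   = d , refl
    ; p<2m     = <-trans (n<1+n _) (even<*2 d<m)
    ; adjacent = inj₁ refl
    ; previous = λ { o (inj₁ o≡2d+2) o≢ → ⊥-elim (o≢ o≡2d+2)
                   ; o (inj₂ refl)  _  → d , refl , left }
    ; tight    = inj₂ (d * 2 , even<*2 (<-trans (n<1+n d) d<m) , inj₂ refl ,
                       <⇒≢ (m<n⇒m<1+n (n<1+n (d * 2))))
    }

  forcedFrom-right : ∀ d → d < m → suc (sinkTime (suc d)) ≡ sinkTime d → ForcedFrom d (suc (d * 2))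
  forcedFrom-right d d<m right = record
    { source   = d , refl
    ; p<2m     = odd<*2 d<m
    ; adjacent = inj₂ refl
    ; previous = λ { o (inj₁ refl) _   → suc d , refl , right
                   ; o (inj₂ refl) o≢ → ⊥-elim (o≢ refl) }
    ; tight    = tight
    }
    where
    tight : sinkTime d ≡ 1 ⊎ ∃ λ o → o < m * 2 × Adjacent (suc (d * 2)) o × o ≢ d * 2
    tight with suc d <? m
    ... | yes 1+d<m = inj₂ (suc d * 2 , even<*2 1+d<m , inj₁ refl ,
                            λ eq → <⇒≢ (m<n⇒m<1+n (n<1+n (d * 2))) (sym eq))
    ... | no  1+d≮m = inj₁ (trans (sym right) (cong suc (trans (cong sinkTime 1+d≡m) sinkTime-end)))
      where
      1+d≡m : suc d ≡ m
      1+d≡m = ≤-antisym d<m (≮⇒≥ 1+d≮m)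

  forcedFrom-sourceOf : ∀ d → d < m → 0 < sinkTime d → ForcedFrom d (sourceOf d)
  forcedFrom-sourceOf d d<m 0<s with leftStep? d
  ... | yes left = forcedFrom-left d d<m left
  ... | no ¬left = forcedFrom-right d d<m (rightStep d<m 0<s ¬left)

  module _ {Γ : Digraph (m * 2)} (path : IsAlternatingPath Γ)
           (firstSink : ∀ v → toℕ v ≡ 0 → IsSink Γ v) where

    sourceAt : ∀ c v → toℕ v ≡ suc (c * 2) → IsSource Γ v
    sourceAt = typeAtOdd (sink-next path) (source-next path) firstSink

    time : Fin (m * 2) → ℕ
    time x = onEven sinkTime (toℕ x)

    forcer : Fin (m * 2) → Fin (m * 2)
    forcer x with sourceOf ⌊ toℕ x /2⌋ <? m * 2
    ... | yes p<2m = fromℕ< p<2m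
    ... | no  _    = x

    toℕ-forcer : ∀ x → sourceOf ⌊ toℕ x /2⌋ < m * 2 → toℕ (forcer x) ≡ sourceOf ⌊ toℕ x /2⌋
    toℕ-forcer x p<2m with sourceOf ⌊ toℕ x /2⌋ <? m * 2
    ... | yes p<2m′ = toℕ-fromℕ< p<2m′
    ... | no  p≮2m  = ⊥-elim (p≮2m p<2m)

    module Forced (x : Fin (m * 2)) (0<tx : 0 < time x) where
      sinkIndex : ∃ λ d → toℕ x ≡ d * 2
      sinkIndex = onEven-pos⇒even sinkTime (toℕ x) 0<tx

      d : ℕ
      d = proj₁ sinkIndex

      x≡2d : toℕ x ≡ d * 2
      x≡2d = proj₂ sinkIndex

      time-sink : ∀ y d′ → toℕ y ≡ d′ * 2 → time y ≡ sinkTime d′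
      time-sink y d′ y≡2d′ = trans (cong (onEven sinkTime) y≡2d′) (onEven-even sinkTime d′)

      tx≡ : time x ≡ sinkTime d
      tx≡ = time-sink x d x≡2d

      forced : ForcedFrom d (sourceOf d)
      forced = forcedFrom-sourceOf d (*-cancelʳ-< 2 d m (subst (_< m * 2) x≡2d (toℕ<n x)))
                            (subst (0 <_) tx≡ 0<tx)
      open ForcedFrom forced

      forcer≡ : toℕ (forcer x) ≡ sourceOf d
      forcer≡ = trans (toℕ-forcer x (subst (_< m * 2) (sym index≡) p<2m)) index≡
        where
        index≡ : sourceOf ⌊ toℕ x /2⌋ ≡ sourceOf d
        index≡ = cong sourceOf (trans (cong ⌊_/2⌋ x≡2d) (⌊d*2/2⌋≡d d))

      forcerSource : IsSource Γ (forcer x)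
      forcerSource = sourceAt (proj₁ source) (forcer x) (trans forcer≡ (proj₂ source))

      arcTo : ∀ y → Adjacent (sourceOf d) (toℕ y) → Γ (forcer x) y ≡ true
      arcTo y adj = source-arc path forcerSource (subst (λ p → Adjacent p (toℕ y)) (sym forcer≡) adj)

      arc : Γ (forcer x) x ≡ true
      arc = arcTo x (subst (Adjacent (sourceOf d)) (sym x≡2d) adjacent)

      earlier : time (forcer x) < time x
      earlier = subst (_< time x) (sym forcer-time) 0<tx
        where
        forcer-time : time (forcer x) ≡ 0
        forcer-time = trans (cong (onEven sinkTime) (trans forcer≡ (proj₂ source)))
                            (onEven-odd sinkTime (proj₁ source))

      previousAt : ∀ y → Adjacent (sourceOf d) (toℕ y) → y ≢ x → suc (time y) ≡ time x
      previousAt y adj y≢x with previous (toℕ y) adj (λ y≡2d → y≢x (toℕ-injective (trans y≡2d (sym x≡2d))))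
      ... | d′ , y≡2d′ , step = trans (cong suc (time-sink y d′ y≡2d′)) (trans step (sym tx≡))

      others : ∀ y → Γ (forcer x) y ≡ true → y ≢ x → time y < time x
      others y fy y≢x = ≤-reflexive (previousAt y adj y≢x)
        where
        adj : Adjacent (sourceOf d) (toℕ y)
        adj = subst (λ p → Adjacent p (toℕ y)) forcer≡ (arc⇒adjacent path fy)

      onTime : time x ≡ 1 ⊎ ∃ λ y → Γ (forcer x) y ≡ true × y ≢ x × suc (time y) ≡ time x
      onTime with tight
      ... | inj₁ s≡1 = inj₁ (trans tx≡ s≡1)
      ... | inj₂ (o , o<2m , adj , o≢2d) = inj₂ (y , arcTo y adj′ , y≢x , previousAt y adj′ y≢x)
        where
        y : Fin (m * 2)
        y = fromℕ< o<2m
        adj′ : Adjacent (sourceOf d) (toℕ y)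
        adj′ = subst (Adjacent (sourceOf d)) (sym (toℕ-fromℕ< o<2m)) adj
        y≢x : y ≢ x
        y≢x y≡x = o≢2d (trans (sym (toℕ-fromℕ< o<2m)) (trans (cong toℕ y≡x) x≡2d))

    normalSchedule : ForcingSchedule Γ T
    normalSchedule = record
      { time           = time
      ; forcer         = forcer
      ; time≤T         = λ x → onEven-≤ sinkTime sinkTime≤T (toℕ x)
      ; forcer-arc     = Forced.arc
      ; forcer-earlier = Forced.earlier
      ; others-earlier = Forced.others
      ; forced-on-time = Forced.onTime
      }

ceilDivOdd-spec : ∀ a q → a ≤ ceilDivOdd a q * suc (2 * q)
ceilDivOdd-spec a q = +-cancelˡ-≤ (2 * q) a (c * suc (2 * q)) (begin
  2 * q + a                                   ≡⟨ +-comm (2 * q) a ⟩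
  a + 2 * q                                   ≡⟨ m≡m%n+[m/n]*n (a + 2 * q) (suc (2 * q)) ⟩
  (a + 2 * q) % suc (2 * q) + c * suc (2 * q) ≤⟨ +-monoˡ-≤ _ (≤-pred (m%n<n (a + 2 * q) (suc (2 * q)))) ⟩
  2 * q + c * suc (2 * q)                     ∎)
  where
  open ≤-Reasoning
  c = ceilDivOdd a q

rounds-cover : ∀ m q → let T = ceilDivOdd (m ∸ q) q in m ≤ T + q * suc (T + T)
rounds-cover m q = begin
  m                   ≤⟨ m≤n+m∸n m q ⟩
  q + (m ∸ q)         ≤⟨ +-monoʳ-≤ q (ceilDivOdd-spec (m ∸ q) q) ⟩
  q + T * suc (2 * q) ≡⟨ rearrange T q ⟩
  T + q * suc (T + T) ∎
  where
  open ≤-Reasoning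
  T = ceilDivOdd (m ∸ q) q
  rearrange : ∀ T q → q + T * suc (2 * q) ≡ T + q * suc (T + T)
  rearrange = solve-∀

module _ (k T q : ℕ) where
  open SinkSchedule (suc k) T
  open NormalSchedule (suc k) T

  private
    m = suc k
    zeros = count (λ d → sinkTime d ≡ᵇ 0) m

  throttling-from : ∀ {Γ : Digraph (m * 2)} → m ≤ T + q * period → (S : ForcingSchedule Γ T) →
                    ∣ initial S ∣ ≡ zeros + m → ThrottlingAtMost Γ (m + T + q)
  throttling-from covered S size = ThrottlingAtMost-mono bound (schedule⇒throttling S)
    where
    open ≤-Reasoning
    bound : ∣ initial S ∣ + T ≤ m + T + q
    bound = begin
      ∣ initial S ∣ + T ≡⟨ cong (_+ T) size ⟩
      zeros + m + T     ≤⟨ +-monoˡ-≤ T (+-monoˡ-≤ m (count-sinkZeros q covered)) ⟩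
      q + m + T         ≡⟨ trans (+-assoc q m T) (+-comm q (m + T)) ⟩
      m + T + q         ∎

  alternatingPath-throttling : m ≤ T + q * period → ∀ {Γ : Digraph (m * 2)} →
                               IsAlternatingPath Γ → ThrottlingAtMost Γ (m + T + q)
  alternatingPath-throttling covered {Γ} path with proj₂ path zero
  ... | inj₂ sink₀ = throttling-from covered (normalSchedule path firstSink)
    (trans (∣tabulate∣≡count (m * 2) (λ e → onEven sinkTime e ≡ᵇ 0)) (count-onEven-zeros m sinkTime))
    where
    firstSink : ∀ v → toℕ v ≡ 0 → IsSink Γ v
    firstSink v v≡0 = subst (IsSink Γ) (sym (toℕ-injective v≡0)) sink₀
  ... | inj₁ source₀ = throttling-from covered
    (schedule-relabel opposite opposite-involutive
      (normalSchedule (reverse-alternatingPath path) lastSink))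
    (trans (∣tabulate∘opposite∣≡count (m * 2) (λ e → onEven sinkTime e ≡ᵇ 0))
           (count-onEven-zeros m sinkTime))
    where
    firstSource : ∀ v → toℕ v ≡ 0 → IsSource Γ v
    firstSource v v≡0 = subst (IsSource Γ) (sym (toℕ-injective v≡0)) source₀
    lastSink : ∀ v → toℕ v ≡ 0 → IsSink (λ u w → Γ (opposite u) (opposite w)) v
    lastSink v v≡0 w = typeAtOdd (source-next path) (sink-next path) firstSource k (opposite v)
      (trans (opposite-prop v) (cong (λ i → m * 2 ∸ suc i) v≡0)) (opposite w)

-- The bound holds for every q.
proposition4p6 : (n : ℕ) → 0 < n → 2 ∣ n → (q : ℕ) → IsCeilP n q →
    (Γ : Digraph n) → IsAlternatingPath Γ →
    ThrottlingAtMost Γ (n / 2 + ceilDivOdd (n / 2 ∸ q) q + q)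
proposition4p6 .(zero * 2)  ()  (divides zero    refl) q _ Γ path
proposition4p6 .(suc k * 2) _   (divides (suc k) refl) q _ Γ path =
  subst (λ m → ThrottlingAtMost Γ (m + ceilDivOdd (m ∸ q) q + q)) (sym (m*n/n≡m (suc k) 2))
    (alternatingPath-throttling k (ceilDivOdd (suc k ∸ q) q) q (rounds-cover (suc k) q) path)
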